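{- Let $(X,R,S)$ and $(X',R',S')$ be modal contact frames and $f:X\to X'$ a map. Then $f:(X,R,S)\to(X',R',S')$ is a regular stable p-morphism if and only if $f:(X,T_R,S)\to(X',T_{R'},S')$ is a p-morphism.
   Context: A modal contact frame is $(X,R,S)$ with $X\neq\emptyset$, $R,S$ binary relations on $X$, $R$ reflexive and symmetric, and such that $xRy$ and $xSz$ imply there is $w$ with $zRw$ and $ySw$. Its associated ternary relation is $T_Rxyz$ iff $yRz$. A map $f:(X,T,S)\to(X',T',S')$ between frames with ternary $T,T'$ and binary $S,S'$ is a p-morphism if: (T1) $Txyz$ implies $T'f(x)f(y)f(z)$; (T2) if $T'f(x)y'z'$ then there are $y,z$ with $Txyz$, $f(y)=y'$, $f(z)=z'$; (S1) $xSy$ implies $f(x)S'f(y)$; (S2) if $f(x)S'y'$ then there is $y$ with $xSy$ and $f(y)=y'$. A map between modal contact frames is a regular stable p-morphism if it satisfies (S1), (S2), (R1) $xRy$ implies $f(x)R'f(y)$, and (R2) if $x'R'y'$ then there are $x,y\in X$ with $xRy$, $f(x)=x'$, $f(y)=y'$. -}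

module Defs where

open import Level using (Level; _⊔_; suc)
open import Data.Product using (Σ; ∃; ∃-syntax; _×_; _,_)
open import Relation.Binary.PropositionalEquality using (_≡_)
open import Relation.Binary.Core using (Rel)
open import Relation.Binary.Definitions using (Reflexive; Symmetric)

Rel₃ : ∀ {a} → Set a → (ℓ : Level) → Set (a ⊔ suc ℓ)
Rel₃ A ℓ = A → A → A → Set ℓ

record ModalContactFrame (a ℓ : Level) : Set (suc (a ⊔ ℓ)) where
  field
    Carrier  : Set a
    R        : Rel Carrier ℓ
    S        : Rel Carrier ℓ
    nonempty : Carrier
    R-refl   : Reflexive R
    R-sym    : Symmetric R
    interact : ∀ {x y z} → R x y → S x z → ∃[ w ] (R z w × S y w)

T[_] : ∀ {a ℓ} {X : Set a} → Rel X ℓ → Rel₃ X ℓ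
T[ R ] x y z = R y z

record IsPMorphism {a a' ℓ ℓ'} {X : Set a} {X' : Set a'}
         (T : Rel₃ X ℓ) (S : Rel X ℓ) (T' : Rel₃ X' ℓ') (S' : Rel X' ℓ')
         (f : X → X') : Set (a ⊔ a' ⊔ ℓ ⊔ ℓ') where
  field
    T1 : ∀ {x y z} → T x y z → T' (f x) (f y) (f z)
    T2 : ∀ {x y' z'} → T' (f x) y' z' →
         ∃[ y ] ∃[ z ] (T x y z × f y ≡ y' × f z ≡ z')
    S1 : ∀ {x y} → S x y → S' (f x) (f y)
    S2 : ∀ {x y'} → S' (f x) y' → ∃[ y ] (S x y × f y ≡ y')

record IsRegularStablePMorphism {a a' ℓ ℓ'} {X : Set a} {X' : Set a'}
         (R S : Rel X ℓ) (R' S' : Rel X' ℓ')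
         (f : X → X') : Set (a ⊔ a' ⊔ ℓ ⊔ ℓ') where
  field
    S1 : ∀ {x y} → S x y → S' (f x) (f y)
    S2 : ∀ {x y'} → S' (f x) y' → ∃[ y ] (S x y × f y ≡ y')
    R1 : ∀ {x y} → R x y → R' (f x) (f y)
    R2 : ∀ {x' y'} → R' x' y' → ∃[ x ] ∃[ y ] (R x y × f x ≡ x' × f y ≡ y')

{-# OPTIONS --safe #-}
-- T_R x y z does not depend on x, so (T1) and (T2) are (R1) and (R2) with an idle
-- first point; recovering (R2) from (T2) only needs some point of X, which a modal
-- contact frame has.
module Submission where

open import Defs
open import Relation.Binary.Core using (Rel)
open import Function.Bundles using (_⇔_; mk⇔)
open ModalContactFrame using (Carrier; R; S; nonempty)

module _ {a a' ℓ ℓ'} {X : Set a} {X' : Set a'}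
         {R S : Rel X ℓ} {R' S' : Rel X' ℓ'} {f : X → X'} where

  regularStable⇒pMorphism : IsRegularStablePMorphism R S R' S' f →
                            IsPMorphism T[ R ] S T[ R' ] S' f
  regularStable⇒pMorphism p = record
    { T1 = R1
    ; T2 = R2
    ; S1 = S1
    ; S2 = S2
    }
    where open IsRegularStablePMorphism p

  pMorphism⇒regularStable : X → IsPMorphism T[ R ] S T[ R' ] S' f →
                            IsRegularStablePMorphism R S R' S' f
  pMorphism⇒regularStable x₀ p = record
    { S1 = S1
    ; S2 = S2
    ; R1 = λ {x} → T1 {x = x}
    ; R2 = T2 {x = x₀}
    }
    where open IsPMorphism p

proposition4p9 : ∀ {a a' ℓ ℓ'} (F : ModalContactFrame a ℓ) (F' : ModalContactFrame a' ℓ')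
                 (f : Carrier F → Carrier F') →
                 IsRegularStablePMorphism (R F) (S F) (R F') (S F') f
                   ⇔ IsPMorphism T[ R F ] (S F) T[ R F' ] (S F') f
proposition4p9 F F' f = mk⇔ regularStable⇒pMorphism (pMorphism⇒regularStable (nonempty F))
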